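{- Let $K\geqslant 1$ and $n_0$ be positive integers. Let $(a_j)_{j\geqslant 1}$ be the increasing sequence of integers consisting of all numbers of the form $k2^n$, where $n\geqslant n_0$ and $k$ ranges over all odd integers in the interval $[2^{K-1}+1,2^K+1]$. Then for all $j\geqslant 1$, $$a_{j+1}\leqslant \left(\frac{2^{K-1}+3}{2^{K-1}+1}\right)a_j.$$ -}

module Defs where

open import Data.Nat using (ℕ; suc; _+_; _*_; _∸_; _^_; _≤_; _<_)
open import Data.Product using (_×_; ∃-syntax)
open import Relation.Binary.PropositionalEquality using (_≡_)

Odd : ℕ → Set
Odd k = ∃[ t ] k ≡ 2 * t + 1

InS : ℕ → ℕ → ℕ → Set
InS K n₀ m = ∃[ n ] ∃[ k ]
  (n₀ ≤ n × Odd k × 2 ^ (K ∸ 1) + 1 ≤ k × k ≤ 2 ^ K + 1 × m ≡ k * 2 ^ n)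

-- (a_j)_{j ≥ 1} is the increasing sequence consisting of all elements of S(K,n₀)
-- (the value a 0 is irrelevant)
IsIncreasingEnumeration : ℕ → ℕ → (ℕ → ℕ) → Set
IsIncreasingEnumeration K n₀ a =
  (∀ j → 1 ≤ j → a j < a (suc j)) ×
  (∀ j → 1 ≤ j → InS K n₀ (a j)) ×
  (∀ m → InS K n₀ m → ∃[ j ] (1 ≤ j × a j ≡ m))

module Submission where

-- Proof idea.  Write M = 2^(K-1), so S = { k·2ⁿ : n ≥ n₀, k odd, M+1 ≤ k ≤ 2M+1 }
-- and the claim reads a_{j+1}·(M+1) ≤ (M+3)·a_j.
--
-- 1. For any strictly increasing enumeration a of a set S, and any m ∈ S with
--    a_j < m, we have a_{j+1} ≤ m (the successor bound).
-- 2. Hence it suffices to exhibit, for each x = k·2ⁿ ∈ S, some m ∈ S with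
--    x < m and m·(M+1) ≤ (M+3)·x.  Taking m = c·2ⁿ for an integer c > k, this
--    reduces to the factor inequality c·(M+1) ≤ (M+3)·k:
--    * if k + 2 ≤ 2M+1, take c = k + 2, i.e. m = (k+2)·2ⁿ;
--    * if k = 2M+1 and K ≥ 2, take m = (M+1)·2ⁿ⁺¹ (M+1 is odd), i.e. c = 2M+2;
--    * if k = 3 and K = 1 (so M = 1), take m = 3·2ⁿ⁺¹, i.e. c = 6.
-- The theorem combines the successor bound with this "nearby element" lemma.

open import Defs
open import Data.Nat using (ℕ; zero; suc; _+_; _*_; _∸_; _^_; _≤_; _<_; z≤n; s≤s)
open import Data.Nat.Properties
open import Data.Nat.Tactic.RingSolver using (solve-∀)
open import Data.Product using (_×_; _,_; ∃-syntax)
open import Relation.Binary.PropositionalEquality using (_≡_; refl; sym; subst)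
open import Data.Sum using (inj₁; inj₂)
open import Relation.Nullary using (¬_; yes; no; contradiction)

module Enumeration
  {P : ℕ → Set} (a : ℕ → ℕ)
  (increasing : ∀ j → 1 ≤ j → a j < a (suc j))
  (covering : ∀ m → P m → ∃[ j ] (1 ≤ j × a j ≡ m))
  where

  monotone : ∀ {j i} → 1 ≤ j → j ≤ i → a j ≤ a i
  monotone {i = zero} 1≤j j≤0 with () ← ≤-trans 1≤j j≤0
  monotone {i = suc i} 1≤j j≤1+i with m≤n⇒m<n∨m≡n j≤1+i
  ... | inj₁ (s≤s j≤i) = ≤-trans (monotone 1≤j j≤i) (<⇒≤ (increasing i (≤-trans 1≤j j≤i)))
  ... | inj₂ refl      = ≤-refl

  -- Successor bound: the term after a_j is at most any element of P above a_j,
  -- because that element occurs at some index i, and i > j by monotonicity.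
  successor-bound : ∀ j → 1 ≤ j → ∀ m → P m → a j < m → a (suc j) ≤ m
  successor-bound j 1≤j m Pm aj<m with covering m Pm
  ... | i , 1≤i , refl with suc j ≤? i
  ...   | yes j<i = monotone (s≤s z≤n) j<i
  ...   | no  j≮i = contradiction aj<m (≤⇒≯ (monotone 1≤i (≤-pred (≰⇒> j≮i))))

next-factor-ratio : ∀ M k → M + 1 ≤ k → (k + 2) * (M + 1) ≤ (M + 3) * k
next-factor-ratio M k M+1≤k = begin
  (k + 2) * (M + 1)       ≡⟨ lhs-expand M k ⟩
  k * M + k + 2 * (M + 1) ≤⟨ +-monoʳ-≤ (k * M + k) (*-monoʳ-≤ 2 M+1≤k) ⟩
  k * M + k + 2 * k       ≡⟨ rhs-expand M k ⟩
  (M + 3) * k             ∎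
  where
  open ≤-Reasoning
  lhs-expand : ∀ M k → (k + 2) * (M + 1) ≡ k * M + k + 2 * (M + 1)
  lhs-expand = solve-∀
  rhs-expand : ∀ M k → k * M + k + 2 * k ≡ (M + 3) * k
  rhs-expand = solve-∀

top-factor-ratio : ∀ M → ((M + 1) * 2) * (M + 1) ≤ (M + 3) * (2 * M + 1)
top-factor-ratio M = subst (((M + 1) * 2) * (M + 1) ≤_) (sym (expand M)) (m≤m+n _ _)
  where
  expand : ∀ M → (M + 3) * (2 * M + 1) ≡ ((M + 1) * 2) * (M + 1) + (3 * M + 1)
  expand = solve-∀

scaled-ratio : ∀ M k c p → c * (M + 1) ≤ (M + 3) * k → (c * p) * (M + 1) ≤ (M + 3) * (k * p)
scaled-ratio M k c p ratio = begin
  (c * p) * (M + 1) ≡⟨ swap-right c p (M + 1) ⟩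
  (c * (M + 1)) * p ≤⟨ *-monoˡ-≤ p ratio ⟩
  ((M + 3) * k) * p ≡⟨ *-assoc (M + 3) k p ⟩
  (M + 3) * (k * p) ∎
  where
  open ≤-Reasoning
  swap-right : ∀ c p q → (c * p) * q ≡ (c * q) * p
  swap-right = solve-∀

Nearby : ℕ → ℕ → ℕ → Set
Nearby K' n₀ x = ∃[ m ] (InS (suc K') n₀ m × x < m × m * (2 ^ K' + 1) ≤ (2 ^ K' + 3) * x)

nearby-by-factor : ∀ K' n₀ n k c → InS (suc K') n₀ (c * 2 ^ n) → k < c →
  c * (2 ^ K' + 1) ≤ (2 ^ K' + 3) * k → Nearby K' n₀ (k * 2 ^ n)
nearby-by-factor K' n₀ n k c c2ⁿ∈S k<c ratio =
  c * 2 ^ n , c2ⁿ∈S , *-monoˡ-< (2 ^ n) {{m^n≢0 2 n}} k<c , scaled-ratio (2 ^ K') k c (2 ^ n) ratio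

odd-successor : ∀ t → 2 * t + 1 + 2 ≡ 2 * suc t + 1
odd-successor = solve-∀

nearby-next : ∀ K' n₀ n t → n₀ ≤ n → 2 ^ K' + 1 ≤ 2 * t + 1 →
  2 * t + 1 + 2 ≤ 2 * 2 ^ K' + 1 → Nearby K' n₀ ((2 * t + 1) * 2 ^ n)
nearby-next K' n₀ n t n₀≤n M+1≤k k+2≤2M+1 =
  nearby-by-factor K' n₀ n k (k + 2)
    (n , k + 2 , n₀≤n , (suc t , odd-successor t) , ≤-trans M+1≤k (m≤m+n k 2) , k+2≤2M+1 , refl)
    (m<m+n k {2} (s≤s z≤n))
    (next-factor-ratio (2 ^ K') k M+1≤k)
  where
  k = 2 * t + 1

-- Case k = 2M+1: for K ≥ 2 the next element is (M+1)·2ⁿ⁺¹ (with M+1 odd),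
-- for K = 1 (where S consists of the 3·2ⁿ) it is 3·2ⁿ⁺¹.
nearby-top : ∀ K' n₀ n → n₀ ≤ n → Nearby K' n₀ ((2 * 2 ^ K' + 1) * 2 ^ n)
nearby-top zero n₀ n n₀≤n =
  nearby-by-factor zero n₀ n 3 6
    (suc n , 3 , ≤-trans n₀≤n (n≤1+n n) , (1 , refl) , s≤s (s≤s z≤n) , ≤-refl , *-assoc 3 2 (2 ^ n))
    (m<m+n 3 {3} (s≤s z≤n))
    ≤-refl
nearby-top (suc K'') n₀ n n₀≤n =
  nearby-by-factor (suc K'') n₀ n (2 * M + 1) ((M + 1) * 2)
    (suc n , M + 1 , ≤-trans n₀≤n (n≤1+n n) , (2 ^ K'' , refl) , ≤-refl ,
       +-monoˡ-≤ 1 (m≤n*m M 2) , *-assoc (M + 1) 2 (2 ^ n))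
    (≤-reflexive (sym (double-successor M)))
    (top-factor-ratio M)
  where
  M = 2 ^ suc K''
  double-successor : ∀ M → (M + 1) * 2 ≡ suc (2 * M + 1)
  double-successor = solve-∀

odd-top : ∀ t M → 2 * t + 1 ≤ 2 * M + 1 → ¬ (2 * t + 1 + 2 ≤ 2 * M + 1) → t ≡ M
odd-top t M k≤2M+1 k+2≰2M+1 = ≤-antisym t≤M (≤-pred M<1+t)
  where
  t≤M : t ≤ M
  t≤M = *-cancelˡ-≤ 2 (+-cancelʳ-≤ 1 (2 * t) (2 * M) k≤2M+1)
  M<1+t : M < suc t
  M<1+t = *-cancelˡ-< 2 M (suc t)
    (+-cancelʳ-< 1 (2 * M) (2 * suc t) (subst (2 * M + 1 <_) (odd-successor t) (≰⇒> k+2≰2M+1)))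

nearby-element : ∀ K' n₀ x → InS (suc K') n₀ x → Nearby K' n₀ x
nearby-element K' n₀ x (n , k , n₀≤n , (t , refl) , M+1≤k , k≤2M+1 , refl)
  with 2 * t + 1 + 2 ≤? 2 * 2 ^ K' + 1
... | yes k+2≤2M+1 = nearby-next K' n₀ n t n₀≤n M+1≤k k+2≤2M+1
... | no  k+2≰2M+1 with refl ← odd-top t (2 ^ K') k≤2M+1 k+2≰2M+1 = nearby-top K' n₀ n n₀≤n

lemma3p4 : (K n₀ : ℕ) → 1 ≤ K → 1 ≤ n₀ → (a : ℕ → ℕ) →
    IsIncreasingEnumeration K n₀ a →
    ∀ j → 1 ≤ j →
      a (suc j) * (2 ^ (K ∸ 1) + 1) ≤ (2 ^ (K ∸ 1) + 3) * a j
lemma3p4 (suc K') n₀ _ _ a (increasing , members , covering) j 1≤j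
  with m , m∈S , aj<m , m-ratio ← nearby-element K' n₀ (a j) (members j 1≤j) =
  ≤-trans (*-monoˡ-≤ (2 ^ K' + 1) (successor-bound j 1≤j m m∈S aj<m)) m-ratio
  where open Enumeration a increasing covering
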